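{- Let $N=pq$ with $p,q$ primes such that $\nu_2(p-1)\neq\nu_2(q-1)$. Let $a\in\mathbb{Z}$ with $\gcd(a,N)=1$ and $\left(\frac{a}{N}\right)_2=1$, and let $v:=\nu_2(N-1)$. Then $a\in\mathbb{Z}_{N,2}^*$ if and only if $\left(\frac{a^{2^v}}{N}\right)_{2^{v+1}}=1$.
   Context: $\nu_2(n):=\max\{k\in\mathbb{N}_0:2^k\mid n\}$. For $k\in\mathbb{N}_0$, a prime $p$ and $a\in\mathbb{Z}$ with $p\nmid a$, $\left(\frac{a}{p}\right)_{2^k}=1$ if there is $x\in\mathbb{Z}$ with $x^{2^k}\equiv a \pmod p$, and $-1$ otherwise; for $n=p_1\cdots p_l$ (primes not necessarily distinct) with $\gcd(n,a)=1$, $\left(\frac{a}{n}\right)_{2^k}:=\prod_i\left(\frac{a}{p_i}\right)_{2^k}$. $\mathbb{Z}_{N,2}^*$ denotes the set of units modulo $N$ that are squares modulo $N$ (quadratic residues modulo $N$). -}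

module Defs where

open import Data.Nat as ℕ using (ℕ; _≤_)
open import Data.Nat.Divisibility as ℕD using ()
open import Data.Nat.Coprimality using (Coprime)
open import Data.Integer as ℤ using (ℤ; +_; _-_; _*_; _^_; 1ℤ)
open import Data.Integer.Divisibility as ℤD using ()
open import Data.List using (List; []; _∷_)
open import Data.Product using (Σ; ∃; _×_)
open import Data.Sum using (_⊎_)
open import Relation.Nullary using (¬_)
open import Relation.Binary.PropositionalEquality using (_≡_)

IsNu2 : ℕ → ℕ → Set
IsNu2 n k = (2 ℕ.^ k) ℕD.∣ n × (∀ j → (2 ℕ.^ j) ℕD.∣ n → j ≤ k)

_≡_[mod_] : ℤ → ℤ → ℕ → Set
x ≡ y [mod m ] = (+ m) ℤD.∣ (x - y)

IsPowRes : ℕ → ℤ → ℕ → Set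
IsPowRes k a p = ∃ λ (x : ℤ) → (x ^ (2 ℕ.^ k)) ≡ a [mod p ]

PowSym : ℕ → ℤ → ℕ → ℤ → Set
PowSym k a p s = (s ≡ 1ℤ × IsPowRes k a p) ⊎ (s ≡ ℤ.-1ℤ × ¬ IsPowRes k a p)

-- PowSymList k a ps s : (a/n)_{2^k} = s for n = product of the primes in ps,
-- i.e. s is the product of the symbols (a/p_i)_{2^k}
PowSymList : ℕ → ℤ → List ℕ → ℤ → Set
PowSymList k a [] s = s ≡ 1ℤ
PowSymList k a (p ∷ ps) s =
  ∃ λ t → ∃ λ u → PowSym k a p t × PowSymList k a ps u × s ≡ t * u

InZStar2 : ℕ → ℤ → Set
InZStar2 N a = Coprime ℤ.∣ a ∣ N × ∃ λ (x : ℤ) → (x ^ 2) ≡ a [mod N ]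

{-# OPTIONS --safe #-}
-- Let e = ν₂(p − 1) < f = ν₂(q − 1) (the other case is symmetric); then ν₂(pq − 1) = e.
-- Modulo p the condition on a^(2^e) always holds: writing p − 1 = 2^e o with o odd, Fermat's
-- little theorem gives a^(2^e) ≡ (a^((o+1)/2))^(2^(e+1)). So the right-hand side says that
-- a^(2^e) ≡ w^(2^(e+1)) modulo q. As 2^(e+1) divides q − 1, a^((q−1)/2) is then a power of
-- w^(q−1) ≡ 1, and by Euler's criterion a is a square modulo q; by (a/N)₂ = 1 it is a square
-- modulo p as well, hence modulo N by the Chinese remainder theorem. The converse is immediate.
-- Fermat and Euler come from Gauss's pairing argument: in the product 1 · 2 ⋯ (q − 1) pair
-- each z with the residue z′ such that z z′ ≡ a.

module Submission where

open import Defs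
open import Data.Nat as ℕ using (ℕ; zero; suc; _<_; _≤_; _∸_; z<s; s≤s)
import Data.Nat.Properties as ℕ
import Data.Nat.Divisibility as ℕD
open import Data.Nat.Coprimality using (Coprime; coprime-Bézout; coprime-divisor; prime⇒coprime)
open import Data.Nat.GCD using (module Bézout)
open import Data.Nat.Induction using (<-rec)
open import Data.Nat.ListAction using (product)
open import Data.Nat.ListAction.Properties using (product-↭)
open import Data.Nat.Primality using (Prime; euclidsLemma; prime⇒irreducible; prime⇒nonZero; prime⇒nonTrivial)
import Data.Nat.Tactic.RingSolver as ℕ-Solver
open import Data.Integer as ℤ using (ℤ; +_; _⊖_; 1ℤ; 0ℤ; -1ℤ)
import Data.Integer.Properties as ℤ
open import Data.Integer.DivMod using (_%ℕ_; _/ℕ_; n%ℕd<d; a≡a%ℕn+[a/ℕn]*n)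
import Data.Integer.Divisibility.Signed as Signed
import Data.Integer.Tactic.RingSolver as ℤ-Solver
open import Data.List using (List; []; _∷_; _++_; length; applyUpTo)
open import Data.List.Properties using (length-applyUpTo)
open import Data.List.Membership.Propositional using (_∈_; _∉_)
open import Data.List.Membership.Propositional.Properties using (∈-∃++; ∈-applyUpTo⁺; ∈-applyUpTo⁻)
open import Data.List.Relation.Unary.Any using (here; there)
open import Data.List.Relation.Unary.AllPairs using (_∷_)
open import Data.List.Relation.Unary.Unique.Propositional using (Unique)
open import Data.List.Relation.Unary.Unique.Propositional.Properties using (applyUpTo⁺₁; drop⁺; Unique[x∷xs]⇒x∉xs)
open import Data.List.Relation.Binary.Subset.Propositional using (_⊆_)
open import Data.List.Relation.Binary.Permutation.Propositional using (_↭_; ↭-sym; ↭-trans; prep; ↭⇒↭ₛ)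
open import Data.List.Relation.Binary.Permutation.Propositional.Properties using (shift; ∈-resp-↭; ↭-length)
import Data.List.Relation.Binary.Permutation.Setoid.Properties as Permutationₛ
open import Data.Product using (∃; ∃₂; _×_; _,_; proj₂)
open import Data.Sum using (_⊎_; inj₁; inj₂; [_,_]′)
open import Function using (id; _∘_)
open import Function.Bundles using (_⇔_; mk⇔; Equivalence)
open import Function.Properties.Equivalence using () renaming (refl to ⇔-refl; trans to ⇔-trans; sym to ⇔-sym)
open import Level using (0ℓ)
open import Relation.Nullary using (¬_; contradiction; Dec; map′)
open import Relation.Nullary.Decidable using (decidable-stable)
open import Relation.Binary.Bundles using (Setoid)
open import Relation.Binary.Structures using (IsEquivalence)
open import Relation.Binary.Definitions using (tri<; tri≈; tri>)
import Relation.Binary.Reasoning.Setoid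
open import Relation.Binary.PropositionalEquality
  using (_≡_; _≢_; refl; sym; trans; cong; cong₂; subst; subst₂; setoid; module ≡-Reasoning)

module TwoAdic where

  open import Data.Nat.Base using (_+_; _*_; _^_)
  open ℕD using (_∣_; divides)
  open ℕ-Solver using (solve-∀)

  parity : ∀ n → ∃ λ h → n ≡ h + h ⊎ n ≡ suc (h + h)
  parity zero = 0 , inj₁ refl
  parity (suc n) with parity n
  ... | h , inj₁ n≡2h   = h , inj₂ (cong suc n≡2h)
  ... | h , inj₂ n≡2h+1 = suc h , inj₁ (trans (cong suc n≡2h+1) (sym (ℕ.+-suc (suc h) h)))

  even≢odd : ∀ m n → m + m ≢ suc (n + n)
  even≢odd zero    n       ()
  even≢odd (suc m) zero    eq with () ← ℕ.suc-injective (trans (cong suc (sym (ℕ.+-suc m m))) eq)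
  even≢odd (suc m) (suc n) eq = even≢odd m n (ℕ.suc-injective (ℕ.suc-injective (begin
    suc (suc (m + m))          ≡⟨ cong suc (ℕ.+-suc m m) ⟨
    suc m + suc m              ≡⟨ eq ⟩
    suc (suc n + suc n)        ≡⟨ cong (suc ∘ suc) (ℕ.+-suc n n) ⟩
    suc (suc (suc (n + n)))    ∎)))
    where open ≡-Reasoning

  ^-mono-∣ : ∀ m {j k} → j ≤ k → m ^ j ∣ m ^ k
  ^-mono-∣ m {j} {k} j≤k = divides (m ^ (k ∸ j)) (begin
    m ^ k                  ≡⟨ cong (m ^_) (ℕ.m+[n∸m]≡n j≤k) ⟨
    m ^ (j + (k ∸ j))      ≡⟨ ℕ.^-distribˡ-+-* m j (k ∸ j) ⟩
    m ^ j * m ^ (k ∸ j)    ≡⟨ ℕ.*-comm (m ^ j) _ ⟩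
    m ^ (k ∸ j) * m ^ j    ∎)
    where open ≡-Reasoning

  2∤odd : ∀ r → ¬ 2 ∣ suc (r + r)
  2∤odd r (divides h 1+2r≡h*2) =
    even≢odd h r (sym (trans 1+2r≡h*2 (trans (ℕ.*-comm h 2) (cong (λ n → h + n) (ℕ.+-identityʳ h)))))

  odd-part⇒IsNu2 : ∀ {n k r} → n ≡ 2 ^ k * suc (r + r) → IsNu2 n k
  odd-part⇒IsNu2 {n} {k} {r} n≡ = divides (suc (r + r)) (trans n≡ (ℕ.*-comm (2 ^ k) _)) , maximal
    where
    maximal : ∀ j → 2 ^ j ∣ n → j ≤ k
    maximal j 2^j∣n with ℕ.≤-<-connex j k
    ... | inj₁ j≤k = j≤k
    ... | inj₂ k<j = contradiction (ℕD.*-cancelˡ-∣ (2 ^ k) {{ℕ.m^n≢0 2 k}} 2^k*2∣2^k*odd) (2∤odd r)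
      where
      2^k*2∣2^k*odd : 2 ^ k * 2 ∣ 2 ^ k * suc (r + r)
      2^k*2∣2^k*odd = subst₂ _∣_ (ℕ.*-comm 2 (2 ^ k)) n≡ (ℕD.∣-trans (^-mono-∣ 2 k<j) 2^j∣n)

  IsNu2⇒odd-part : ∀ {n k} → IsNu2 n k → ∃ λ r → n ≡ 2 ^ k * suc (r + r)
  IsNu2⇒odd-part {n} {k} (divides m n≡m*2^k , maximal) with parity m
  ... | r , inj₂ m≡1+2r = r , trans n≡m*2^k (trans (ℕ.*-comm m _) (cong (2 ^ k *_) m≡1+2r))
  ... | r , inj₁ m≡2r   = contradiction (maximal (suc k) (divides r n≡r*2^[1+k])) (ℕ.n≮n k)
    where
    n≡r*2^[1+k] : n ≡ r * 2 ^ suc k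
    n≡r*2^[1+k] = trans n≡m*2^k (trans (cong (_* 2 ^ k) m≡2r) (lemma r (2 ^ k)))
      where lemma : ∀ r x → (r + r) * x ≡ r * (2 * x)
            lemma = solve-∀

  IsNu2-unique : ∀ {n k l} → IsNu2 n k → IsNu2 n l → k ≡ l
  IsNu2-unique (2^k∣n , k-max) (2^l∣n , l-max) = ℕ.≤-antisym (l-max _ 2^k∣n) (k-max _ 2^l∣n)

  odd-part : ∀ n → n ≢ 0 → ∃₂ λ k r → n ≡ 2 ^ k * suc (r + r)
  odd-part = <-rec _ go
    where
    go : ∀ n → (∀ {m} → m < n → m ≢ 0 → ∃₂ λ k r → m ≡ 2 ^ k * suc (r + r)) →
         n ≢ 0 → ∃₂ λ k r → n ≡ 2 ^ k * suc (r + r)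
    go n rec n≢0 with parity n
    ... | h , inj₂ n≡1+2h = 0 , h , trans n≡1+2h (sym (ℕ.*-identityˡ _))
    ... | h , inj₁ n≡2h = let k , r , h≡ = rec h<n h≢0 in suc k , r , (begin
      n                                              ≡⟨ n≡2h ⟩
      h + h                                          ≡⟨ cong (λ m → m + m) h≡ ⟩
      2 ^ k * suc (r + r) + 2 ^ k * suc (r + r)      ≡⟨ lemma (2 ^ k) (suc (r + r)) ⟩
      2 ^ suc k * suc (r + r)                        ∎)
      where
      open ≡-Reasoning
      h≢0 : h ≢ 0
      h≢0 refl = n≢0 n≡2h
      h<n : h < n
      h<n = subst (h <_) (sym n≡2h) (ℕ.m<m+n h (ℕ.n≢0⇒n>0 h≢0))
      lemma : ∀ x o → x * o + x * o ≡ (2 * x) * o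
      lemma = solve-∀

  IsNu2-exists : ∀ {n} → n ≢ 0 → ∃ (IsNu2 n)
  IsNu2-exists {n} n≢0 with k , r , n≡ ← odd-part n n≢0 = k , odd-part⇒IsNu2 {r = r} n≡

  IsNu2⇒∣ : ∀ {n e f} → IsNu2 n f → e ≤ f → 2 ^ e ∣ n
  IsNu2⇒∣ (2^f∣n , _) e≤f = ℕD.∣-trans (^-mono-∣ 2 e≤f) 2^f∣n

  IsNu2-pred-* : ∀ {p q e f} .{{_ : ℕ.NonZero p}} .{{_ : ℕ.NonZero q}} →
                 IsNu2 (p ∸ 1) e → IsNu2 (q ∸ 1) f → e < f → IsNu2 (p * q ∸ 1) e
  IsNu2-pred-* {suc P} {suc Q} {e} ν₂[P]≡e ν₂[Q]≡f e<f
    with r , P≡ ← IsNu2⇒odd-part ν₂[P]≡e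
    with divides t Q≡ ← IsNu2⇒∣ ν₂[Q]≡f e<f
    -- (1 + 2^e o)(1 + 2^(e+1) t) − 1 = 2^e (o + 2t + 2^(e+1) o t) with o = 1 + 2r odd.
    = odd-part⇒IsNu2 {r = R} (begin
      Q + P * suc Q                                               ≡⟨ cong₂ (λ x y → x + y * suc x) Q≡ P≡ ⟩
      t * 2 ^ suc e + 2 ^ e * suc (r + r) * suc (t * 2 ^ suc e)   ≡⟨ lemma r t (2 ^ e) ⟩
      2 ^ e * suc (R + R)                                         ∎)
    where
    open ≡-Reasoning
    R : ℕ
    R = r + t + 2 ^ e * t * suc (r + r)
    lemma : ∀ r t E → t * (2 * E) + E * suc (r + r) * suc (t * (2 * E))
                    ≡ E * suc (r + t + E * t * suc (r + r) + (r + t + E * t * suc (r + r)))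
    lemma = solve-∀

  IsNu2⇒pred-halves : ∀ {q e f} .{{_ : ℕ.NonZero q}} → IsNu2 (q ∸ 1) f → e < f →
                      ∃ λ t → q ≡ suc (2 ^ e * t + 2 ^ e * t)
  IsNu2⇒pred-halves {suc Q} {e} ν₂[Q]≡f e<f with divides t Q≡ ← IsNu2⇒∣ ν₂[Q]≡f e<f =
    t , cong suc (trans Q≡ (lemma t (2 ^ e)))
    where lemma : ∀ t E → t * (2 * E) ≡ E * t + E * t
          lemma = solve-∀

open TwoAdic
open import Data.Integer.Base using (_+_; _-_; _*_; -_; _^_)
open Signed using (_∣_; divides)
open ℤ-Solver using (solve-∀)

-- Congruence modulo m

-- The congruence _≡_[mod_] as a record over signed divisibility, so that x and y can be
-- inferred from a proof (in _≡_[mod_] they are hidden under ∣_∣).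
infix 4 _≈_[mod_]
record _≈_[mod_] (x y : ℤ) (m : ℕ) : Set where
  constructor divides-diff
  field ∣-diff : + m ∣ x - y

module _ {m : ℕ} where

  ≈⇒≡[mod] : ∀ {x y} → x ≈ y [mod m ] → x ≡ y [mod m ]
  ≈⇒≡[mod] (divides-diff d) = Signed.∣⇒∣ᵤ d

  ≡[mod]⇒≈ : ∀ {x y} → x ≡ y [mod m ] → x ≈ y [mod m ]
  ≡[mod]⇒≈ d = divides-diff (Signed.∣ᵤ⇒∣ d)

  private
    ∣⇒≈ : ∀ {x y u} → u ≡ x - y → + m ∣ u → x ≈ y [mod m ]
    ∣⇒≈ refl d = divides-diff d

  ≈-reflexive : ∀ {x y} → x ≡ y → x ≈ y [mod m ]
  ≈-reflexive {x} refl = ∣⇒≈ (sym (ℤ.+-inverseʳ x)) (divides 0ℤ refl)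

  ≈-refl : ∀ {x} → x ≈ x [mod m ]
  ≈-refl = ≈-reflexive refl

  ≈-sym : ∀ {x y} → x ≈ y [mod m ] → y ≈ x [mod m ]
  ≈-sym {x} {y} (divides-diff d) = ∣⇒≈ (lemma x y) (Signed.∣m⇒∣-m d)
    where lemma : ∀ x y → - (x - y) ≡ y - x
          lemma = solve-∀

  ≈-trans : ∀ {x y z} → x ≈ y [mod m ] → y ≈ z [mod m ] → x ≈ z [mod m ]
  ≈-trans {x} {y} {z} (divides-diff d) (divides-diff e) = ∣⇒≈ (lemma x y z) (Signed.∣m∣n⇒∣m+n d e)
    where lemma : ∀ x y z → (x - y) + (y - z) ≡ x - z
          lemma = solve-∀

  ≈-isEquivalence : IsEquivalence (λ x y → x ≈ y [mod m ])
  ≈-isEquivalence = record { refl = ≈-refl ; sym = ≈-sym ; trans = ≈-trans }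

  +-cong : ∀ {x y u v} → x ≈ y [mod m ] → u ≈ v [mod m ] → x + u ≈ y + v [mod m ]
  +-cong {x} {y} {u} {v} (divides-diff d) (divides-diff e) = ∣⇒≈ (lemma x y u v) (Signed.∣m∣n⇒∣m+n d e)
    where lemma : ∀ x y u v → (x - y) + (u - v) ≡ (x + u) - (y + v)
          lemma = solve-∀

  -‿cong : ∀ {x y} → x ≈ y [mod m ] → - x ≈ - y [mod m ]
  -‿cong {x} {y} (divides-diff d) = ∣⇒≈ (lemma x y) (Signed.∣m⇒∣-m d)
    where lemma : ∀ x y → - (x - y) ≡ - x - - y
          lemma = solve-∀

  *-cong : ∀ {x y u v} → x ≈ y [mod m ] → u ≈ v [mod m ] → x * u ≈ y * v [mod m ]
  *-cong {x} {y} {u} {v} (divides-diff d) (divides-diff e) =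
    ∣⇒≈ (lemma x y u v) (Signed.∣m∣n⇒∣m+n (Signed.∣m⇒∣m*n u d) (Signed.∣n⇒∣m*n y e))
    where lemma : ∀ x y u v → (x - y) * u + y * (u - v) ≡ x * u - y * v
          lemma = solve-∀

  *-congˡ : ∀ x {u v} → u ≈ v [mod m ] → x * u ≈ x * v [mod m ]
  *-congˡ x = *-cong (≈-refl {x})

  *-congʳ : ∀ u {x y} → x ≈ y [mod m ] → x * u ≈ y * u [mod m ]
  *-congʳ u x≈y = *-cong x≈y (≈-refl {u})

  ^-cong : ∀ {x y} n → x ≈ y [mod m ] → x ^ n ≈ y ^ n [mod m ]
  ^-cong zero    x≈y = ≈-refl
  ^-cong (suc n) x≈y = *-cong x≈y (^-cong n x≈y)

  ∣⇒≈0 : ∀ {x} → + m ∣ x → x ≈ 0ℤ [mod m ]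
  ∣⇒≈0 {x} = ∣⇒≈ (sym (ℤ.+-identityʳ x))

  ≈0⇒∣ : ∀ {x} → x ≈ 0ℤ [mod m ] → + m ∣ x
  ≈0⇒∣ {x} (divides-diff d) = subst (+ m ∣_) (ℤ.+-identityʳ x) d

  ∣⇒∣^ : ∀ {x} n .{{_ : ℕ.NonZero n}} → + m ∣ x → + m ∣ x ^ n
  ∣⇒∣^ {x} (suc n) m∣x = Signed.∣m⇒∣m*n (x ^ n) m∣x

  ∣-resp-≈ : ∀ {x y} → x ≈ y [mod m ] → + m ∣ x → + m ∣ y
  ∣-resp-≈ x≈y m∣x = ≈0⇒∣ (≈-trans (≈-sym x≈y) (∣⇒≈0 m∣x))

  +-multiple≈ : ∀ x k → x + k * + m ≈ x [mod m ]
  +-multiple≈ x k = ∣⇒≈ (lemma x k (+ m)) (divides k refl)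
    where lemma : ∀ x k m → k * m ≡ x + k * m - x
          lemma = solve-∀

  ≈-dec : ∀ x y → Dec (x ≈ y [mod m ])
  ≈-dec x y = map′ ≡[mod]⇒≈ ≈⇒≡[mod] (m ℕD.∣? ℤ.∣ x - y ∣)

  ∸≈- : ∀ {r} → r ≤ m → + (m ∸ r) ≈ - + r [mod m ]
  ∸≈- {r} r≤m = ∣⇒≈ (begin
    1ℤ * + m                 ≡⟨ lemma (+ m) (+ r) ⟩
    (+ m - + r) - - + r      ≡⟨ cong (_- - + r) (ℤ.m-n≡m⊖n m r) ⟩
    m ⊖ r - - + r            ≡⟨ cong (_- - + r) (ℤ.⊖-≥ r≤m) ⟩
    + (m ∸ r) - - + r        ∎) (divides 1ℤ refl)
    where open ≡-Reasoning
          lemma : ∀ m r → 1ℤ * m ≡ (m - r) - - r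
          lemma = solve-∀

≈-setoid : ℕ → Setoid 0ℓ 0ℓ
≈-setoid m = record { isEquivalence = ≈-isEquivalence {m} }

module ≈-Reasoning (m : ℕ) = Relation.Binary.Reasoning.Setoid (≈-setoid m)

∣∧<⇒≡0 : ∀ {m n} → m ℕD.∣ n → n < m → n ≡ 0
∣∧<⇒≡0 {n = zero}  _   _   = refl
∣∧<⇒≡0 {n = suc n} m∣n n<m = contradiction (ℕD.∣⇒≤ m∣n) (ℕ.<⇒≱ n<m)

module _ {m : ℕ} where

  private
    residue-≤ : ∀ {r s} → r ≤ s → s < m → + r ≈ + s [mod m ] → s ≤ r
    residue-≤ {r} {s} r≤s s<m r≈s = ℕ.m∸n≡0⇒m≤n (∣∧<⇒≡0 m∣s∸r (ℕ.≤-<-trans (ℕ.m∸n≤m s r) s<m))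
      where
      m∣s∸r : m ℕD.∣ s ∸ r
      m∣s∸r = subst (m ℕD.∣_) (trans (cong ℤ.∣_∣ (ℤ.m-n≡m⊖n r s)) (ℤ.∣⊖∣-≤ r≤s)) (≈⇒≡[mod] r≈s)

  residue-≡ : ∀ {r s} → r < m → s < m → + r ≈ + s [mod m ] → r ≡ s
  residue-≡ {r} {s} r<m s<m r≈s with ℕ.≤-total r s
  ... | inj₁ r≤s = ℕ.≤-antisym r≤s (residue-≤ r≤s s<m r≈s)
  ... | inj₂ s≤r = sym (ℕ.≤-antisym s≤r (residue-≤ s≤r r<m (≈-sym r≈s)))

  reduce : .{{_ : ℕ.NonZero m}} → ∀ x → ∃ λ r → r < m × x ≈ + r [mod m ]
  reduce x = x %ℕ m , n%ℕd<d x m ,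
    ≈-trans (≈-reflexive (a≡a%ℕn+[a/ℕn]*n x m)) (+-multiple≈ (+ (x %ℕ m)) (x /ℕ m))

-- Prime moduli

prime⇒≢1 : ∀ {p} → Prime p → p ≢ 1
prime⇒≢1 p-prime = ℕ.nonTrivial⇒≢1 {{prime⇒nonTrivial p-prime}}

prime⇒>1 : ∀ {p} → Prime p → 1 < p
prime⇒>1 {p} p-prime = ℕ.nonTrivial⇒n>1 p {{prime⇒nonTrivial p-prime}}

module _ {q : ℕ} (q-prime : Prime q) where

  private instance
    q≢0 : ℕ.NonZero q
    q≢0 = prime⇒nonZero q-prime

  ∣*⇒∣⊎∣ : ∀ x y → + q ∣ x * y → + q ∣ x ⊎ + q ∣ y
  ∣*⇒∣⊎∣ x y q∣xy
    with euclidsLemma ℤ.∣ x ∣ ℤ.∣ y ∣ q-prime (subst (q ℕD.∣_) (ℤ.abs-* x y) (Signed.∣⇒∣ᵤ q∣xy))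
  ... | inj₁ q∣x = inj₁ (Signed.∣ᵤ⇒∣ q∣x)
  ... | inj₂ q∣y = inj₂ (Signed.∣ᵤ⇒∣ q∣y)

  ∤*∤⇒∤* : ∀ {x y} → ¬ + q ∣ x → ¬ + q ∣ y → ¬ + q ∣ x * y
  ∤*∤⇒∤* {x} {y} q∤x q∤y q∣xy = [ q∤x , q∤y ]′ (∣*⇒∣⊎∣ x y q∣xy)

  ∤⇒∤^ : ∀ {x} n → ¬ + q ∣ x → ¬ + q ∣ x ^ n
  ∤⇒∤^ zero    q∤x q∣1 = prime⇒≢1 q-prime (ℕD.∣1⇒≡1 (Signed.∣⇒∣ᵤ q∣1))
  ∤⇒∤^ (suc n) q∤x     = ∤*∤⇒∤* q∤x (∤⇒∤^ n q∤x)

  *-cancelˡ-≈ : ∀ {c x y} → ¬ + q ∣ c → c * x ≈ c * y [mod q ] → x ≈ y [mod q ]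
  *-cancelˡ-≈ {c} {x} {y} q∤c (divides-diff q∣cx-cy)
    with ∣*⇒∣⊎∣ c (x - y) (subst (+ q ∣_) (lemma c x y) q∣cx-cy)
    where lemma : ∀ c x y → c * x - c * y ≡ c * (x - y)
          lemma = solve-∀
  ... | inj₁ q∣c = contradiction q∣c q∤c
  ... | inj₂ q∣x-y = divides-diff q∣x-y

  residue-inverse : ∀ {r} → 0 < r → r < q → ∃ λ u → + r * u ≈ 1ℤ [mod q ]
  residue-inverse {r} 0<r r<q with coprime-Bézout (prime⇒coprime q-prime {{ℕ.>-nonZero 0<r}} r<q)
  ... | Bézout.+- x y eq = - + y , ≈-sym (divides-diff (divides (+ x) (begin
    1ℤ - + r * - + y    ≡⟨ lemma (+ r) (+ y) ⟩
    1ℤ + + y * + r      ≡⟨ cong (λ t → 1ℤ + t) (ℤ.pos-* y r) ⟨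
    + (1 ℕ.+ y ℕ.* r)   ≡⟨ cong +_ eq ⟩
    + (x ℕ.* q)         ≡⟨ ℤ.pos-* x q ⟩
    + x * + q           ∎)))
    where open ≡-Reasoning
          lemma : ∀ r y → 1ℤ - r * - y ≡ 1ℤ + y * r
          lemma = solve-∀
  ... | Bézout.-+ x y eq = + y , divides-diff (divides (+ x) (begin
    + r * + y - 1ℤ           ≡⟨ cong (_- 1ℤ) (ℤ.*-comm (+ r) (+ y)) ⟩
    + y * + r - 1ℤ           ≡⟨ cong (_- 1ℤ) (ℤ.pos-* y r) ⟨
    + (y ℕ.* r) - 1ℤ         ≡⟨ cong (λ t → + t - 1ℤ) eq ⟨
    1ℤ + + (x ℕ.* q) - 1ℤ    ≡⟨ cong (λ t → 1ℤ + t - 1ℤ) (ℤ.pos-* x q) ⟩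
    1ℤ + + x * + q - 1ℤ      ≡⟨ lemma (+ x * + q) ⟩
    + x * + q                ∎))
    where open ≡-Reasoning
          lemma : ∀ t → 1ℤ + t - 1ℤ ≡ t
          lemma = solve-∀

  nonzero-residue : ∀ {x} → ¬ + q ∣ x → ∃ λ r → (0 < r × r < q) × x ≈ + r [mod q ]
  nonzero-residue {x} q∤x with reduce {m = q} x
  ... | zero  , _   , x≈0 = contradiction (≈0⇒∣ x≈0) q∤x
  ... | suc r , r<q , x≈r = suc r , (ℕ.z<s , r<q) , x≈r

  inverse : ∀ {x} → ¬ + q ∣ x → ∃ λ u → x * u ≈ 1ℤ [mod q ]
  inverse q∤x =
    let r , (0<r , r<q) , x≈r = nonzero-residue q∤x
        u , ru≈1 = residue-inverse 0<r r<q
    in u , ≈-trans (*-congʳ u x≈r) ru≈1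

  division : ∀ {x} → ¬ + q ∣ x → ∀ c → ∃ λ w → w < q × x * + w ≈ c [mod q ]
  division {x} q∤x c =
    let u , xu≈1 = inverse q∤x
        w , w<q , uc≈w = reduce {m = q} (u * c)
        open ≈-Reasoning q
    in w , w<q , (begin
      x * + w        ≈⟨ *-congˡ x uc≈w ⟨
      x * (u * c)    ≡⟨ ℤ.*-assoc x u c ⟨
      (x * u) * c    ≈⟨ *-congʳ c xu≈1 ⟩
      1ℤ * c         ≡⟨ ℤ.*-identityˡ c ⟩
      c              ∎)

  square-roots : ∀ {r z} → 0 < r → r < q → z < q → + z * + z ≈ + r * + r [mod q ] → z ≡ r ⊎ z ≡ q ∸ r
  square-roots {r} {z} 0<r r<q z<q (divides-diff q∣z²-r²)
    with ∣*⇒∣⊎∣ (+ z - + r) (+ z + + r) (subst (+ q ∣_) (lemma (+ z) (+ r)) q∣z²-r²)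
    where lemma : ∀ z r → z * z - r * r ≡ (z - r) * (z + r)
          lemma = solve-∀
  ... | inj₁ q∣z-r = inj₁ (residue-≡ z<q r<q (divides-diff q∣z-r))
  ... | inj₂ q∣z+r = inj₂ (residue-≡ z<q (ℕ.∸-monoʳ-< 0<r (ℕ.<⇒≤ r<q))
                             (≈-trans z≈-r (≈-sym (∸≈- (ℕ.<⇒≤ r<q)))))
    where z≈-r : + z ≈ - + r [mod q ]
          z≈-r = divides-diff (subst (+ q ∣_) (lemma (+ z) (+ r)) q∣z+r)
            where lemma : ∀ z r → z + r ≡ z - - r
                  lemma = solve-∀

-- Pairing residues modulo a prime

units : ℕ → List ℕ
units q = applyUpTo suc (q ∸ 1)

<∸1⇒suc< : ∀ {i q} → i < q ∸ 1 → suc i < q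
<∸1⇒suc< {q = suc q} i<q = ℕ.s<s i<q

module _ {q : ℕ} where

  ∈-units⁻ : ∀ {z} → z ∈ units q → 0 < z × z < q
  ∈-units⁻ z∈ with i , i<q-1 , refl ← ∈-applyUpTo⁻ suc z∈ = ℕ.z<s , <∸1⇒suc< i<q-1

  ∈-units⁺ : ∀ {z} → 0 < z → z < q → z ∈ units q
  ∈-units⁺ {suc z} _ z<q = ∈-applyUpTo⁺ suc (ℕ.∸-monoˡ-< z<q (ℕ.s≤s ℕ.z≤n))

  units-unique : Unique (units q)
  units-unique = applyUpTo⁺₁ suc (q ∸ 1) (λ i<j _ → ℕ.<⇒≢ i<j ∘ ℕ.suc-injective)

  ∈-units⇒∤ : ∀ {z} → z ∈ units q → ¬ + q ∣ + z
  ∈-units⇒∤ z∈ q∣z with 0<z , z<q ← ∈-units⁻ z∈ =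
    ℕ.<⇒≢ 0<z (sym (∣∧<⇒≡0 (Signed.∣⇒∣ᵤ q∣z) z<q))

extract : ∀ {A : Set} {x : A} {xs} → x ∈ xs → ∃ λ ys → xs ↭ x ∷ ys
extract {x = x} x∈xs with as , bs , refl ← ∈-∃++ x∈xs = as ++ bs , shift x as bs

extract₂ : ∀ {A : Set} {x y : A} {xs} → x ∈ xs → y ∈ xs → x ≢ y → ∃ λ ys → xs ↭ x ∷ y ∷ ys
extract₂ x∈xs y∈xs x≢y with ys , xs↭x∷ys ← extract x∈xs with ∈-resp-↭ xs↭x∷ys y∈xs
... | here y≡x = contradiction (sym y≡x) x≢y
... | there y∈ys with zs , ys↭y∷zs ← extract y∈ys = zs , ↭-trans xs↭x∷ys (prep _ ys↭y∷zs)

Unique[x∷y∷ys]⇒∉ys : ∀ {A : Set} {x y u : A} {ys} → Unique (x ∷ y ∷ ys) → u ∈ x ∷ y ∷ [] → u ∉ ys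
Unique[x∷y∷ys]⇒∉ys unique             (here refl)         = Unique[x∷xs]⇒x∉xs unique ∘ there
Unique[x∷y∷ys]⇒∉ys (_ ∷ y∷ys-unique) (there (here refl)) = Unique[x∷xs]⇒x∉xs y∷ys-unique

Unique-resp-↭ : ∀ {A : Set} {xs ys : List A} → xs ↭ ys → Unique xs → Unique ys
Unique-resp-↭ {A} = Permutationₛ.Unique-resp-↭ (setoid A) ∘ ↭⇒↭ₛ

+product-↭∷∷ : ∀ {xs x y ys} → xs ↭ x ∷ y ∷ ys → + product xs ≡ + x * (+ y * + product ys)
+product-↭∷∷ {xs} {x} {y} {ys} xs↭ = begin
  + product xs                   ≡⟨ cong +_ (product-↭ xs↭) ⟩
  + (x ℕ.* (y ℕ.* product ys))   ≡⟨ ℤ.pos-* x _ ⟩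
  + x * + (y ℕ.* product ys)     ≡⟨ cong (+ x *_) (ℤ.pos-* y _) ⟩
  + x * (+ y * + product ys)     ∎
  where open ≡-Reasoning

module _ {q : ℕ} (q-prime : Prime q) (c : ℤ) where

  HasPartners : List ℕ → Set
  HasPartners L = ∀ {z} → z ∈ L → ∃ λ w → w ∈ L × + z * + w ≈ c [mod q ]

  NoSquareRoot : List ℕ → Set
  NoSquareRoot L = ∀ {z} → z ∈ L → ¬ + z * + z ≈ c [mod q ]

  partner-unique : ∀ {z w w′} → z ∈ units q → w < q → w′ < q →
                   + z * + w ≈ c [mod q ] → + z * + w′ ≈ c [mod q ] → w ≡ w′
  partner-unique z∈ w<q w′<q zw≈c zw′≈c =
    residue-≡ w<q w′<q (*-cancelˡ-≈ q-prime (∈-units⇒∤ z∈) (≈-trans zw≈c (≈-sym zw′≈c)))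

  HasPartners-resp-↭ : ∀ {xs ys} → xs ↭ ys → HasPartners xs → HasPartners ys
  HasPartners-resp-↭ xs↭ys partners z∈ys
    with w , w∈xs , zw≈c ← partners (∈-resp-↭ (↭-sym xs↭ys) z∈ys) = w , ∈-resp-↭ xs↭ys w∈xs , zw≈c

  -- Partners are unique and those of x and y lie in {x, y}, so no element of ys is paired
  -- with x or y.
  HasPartners-drop : ∀ {x y x′ y′ ys} → Unique (x ∷ y ∷ ys) → x ∷ y ∷ ys ⊆ units q →
    x′ ∈ x ∷ y ∷ [] → + x * + x′ ≈ c [mod q ] →
    y′ ∈ x ∷ y ∷ [] → + y * + y′ ≈ c [mod q ] →
    HasPartners (x ∷ y ∷ ys) → HasPartners ys
  HasPartners-drop {x} {y} {x′} {y′} {ys} unique ⊆units x′∈ xx′≈c y′∈ yy′≈c partners {z} z∈ys =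
    keep (partners (there (there z∈ys)))
    where
    bound : ∀ {u} → u ∈ x ∷ y ∷ ys → u < q
    bound = proj₂ ∘ ∈-units⁻ ∘ ⊆units

    pair⊆ : ∀ {u} → u ∈ x ∷ y ∷ [] → u ∈ x ∷ y ∷ ys
    pair⊆ (here refl)         = here refl
    pair⊆ (there (here refl)) = there (here refl)

    not-a-partner : ∀ {u u′} → u ∈ x ∷ y ∷ ys → u′ ∈ x ∷ y ∷ [] →
                    + u * + u′ ≈ c [mod q ] → ¬ + z * + u ≈ c [mod q ]
    not-a-partner {u} {u′} u∈ u′∈ uu′≈c zu≈c =
      Unique[x∷y∷ys]⇒∉ys unique u′∈ (subst (_∈ ys) z≡u′ z∈ys)
      where
      z≡u′ : z ≡ u′
      z≡u′ = partner-unique (⊆units u∈) (bound (there (there z∈ys))) (bound (pair⊆ u′∈))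
               (≈-trans (≈-reflexive (ℤ.*-comm (+ u) (+ z))) zu≈c) uu′≈c

    keep : (∃ λ w → w ∈ x ∷ y ∷ ys × + z * + w ≈ c [mod q ]) →
           ∃ λ w → w ∈ ys × + z * + w ≈ c [mod q ]
    keep (w , here refl         , zw≈c) = contradiction zw≈c (not-a-partner (here refl) x′∈ xx′≈c)
    keep (w , there (here refl) , zw≈c) = contradiction zw≈c (not-a-partner (there (here refl)) y′∈ yy′≈c)
    keep (w , there (there w∈ys) , zw≈c) = w , w∈ys , zw≈c

  product-of-partners : ∀ k {L} → length L ≡ k ℕ.+ k → Unique L → L ⊆ units q →
    HasPartners L → NoSquareRoot L → + product L ≈ c ^ k [mod q ]
  product-of-partners zero    {[]}     _   _      _      _        _       = ≈-refl
  product-of-partners (suc k) {x ∷ xs} len unique ⊆units partners no-root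
    with y , y∈ , xy≈c ← partners (here refl)
    with ys , L↭ ← extract₂ (here refl) y∈ (λ { refl → no-root (here refl) xy≈c }) = begin
      + product (x ∷ xs)                 ≡⟨ +product-↭∷∷ L↭ ⟩
      + x * (+ y * + product ys)         ≡⟨ ℤ.*-assoc (+ x) (+ y) _ ⟨
      (+ x * + y) * + product ys         ≈⟨ *-cong xy≈c product-ys ⟩
      c * c ^ k                          ∎
    where
    open ≈-Reasoning q
    from-ys : ∀ {z} → z ∈ ys → z ∈ x ∷ xs
    from-ys = ∈-resp-↭ (↭-sym L↭) ∘ there ∘ there
    unique′ : Unique (x ∷ y ∷ ys)
    unique′ = Unique-resp-↭ L↭ unique
    length-ys : length ys ≡ k ℕ.+ k
    length-ys = ℕ.suc-injective (ℕ.suc-injective (trans (sym (↭-length L↭)) (trans len (cong suc (ℕ.+-suc k k)))))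
    unique-ys : Unique ys
    unique-ys = drop⁺ 2 unique′
    ⊆units-ys : ys ⊆ units q
    ⊆units-ys = ⊆units ∘ from-ys
    partners-ys : HasPartners ys
    partners-ys = HasPartners-drop unique′ (⊆units ∘ ∈-resp-↭ (↭-sym L↭)) (there (here refl)) xy≈c (here refl)
                    (≈-trans (≈-reflexive (ℤ.*-comm (+ y) (+ x))) xy≈c) (HasPartners-resp-↭ L↭ partners)
    no-root-ys : NoSquareRoot ys
    no-root-ys = no-root ∘ from-ys
    product-ys : + product ys ≈ c ^ k [mod q ]
    product-ys = product-of-partners k length-ys unique-ys ⊆units-ys partners-ys no-root-ys

-- Wilson's theorem, Euler's criterion and Fermat's little theorem

module _ {q h : ℕ} (q-prime : Prime q) (q≡1+2h : q ≡ suc (h ℕ.+ h)) where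

  private
    h≢0 : h ≢ 0
    h≢0 refl = prime⇒≢1 q-prime q≡1+2h

    k : ℕ
    k = ℕ.pred h

    h≡1+k : h ≡ suc k
    h≡1+k = sym (ℕ.suc-pred h {{ℕ.≢-nonZero h≢0}})

  length-units : length (units q) ≡ h ℕ.+ h
  length-units = trans (length-applyUpTo suc (q ∸ 1)) (cong (_∸ 1) q≡1+2h)

  private
    length-drop₂ : ∀ {x y ys} → units q ↭ x ∷ y ∷ ys → length ys ≡ k ℕ.+ k
    length-drop₂ {ys = ys} units↭ = ℕ.suc-injective (ℕ.suc-injective (begin
      suc (suc (length ys))   ≡⟨ ↭-length units↭ ⟨
      length (units q)        ≡⟨ length-units ⟩
      h ℕ.+ h                 ≡⟨ cong (λ n → n ℕ.+ n) h≡1+k ⟩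
      suc k ℕ.+ suc k         ≡⟨ cong suc (ℕ.+-suc k k) ⟩
      suc (suc (k ℕ.+ k))     ∎))
      where open ≡-Reasoning

  units-partners : ∀ {a} → ¬ + q ∣ a → HasPartners q-prime a (units q)
  units-partners {a} q∤a {z} z∈ =
    let w , w<q , zw≈a = division q-prime (∈-units⇒∤ z∈) a
    in w , ∈-units⁺ (nonzero w zw≈a) w<q , zw≈a
    where
    nonzero : ∀ w → + z * + w ≈ a [mod q ] → 0 < w
    nonzero zero    z0≈a =
      contradiction (≈0⇒∣ (≈-trans (≈-sym z0≈a) (≈-reflexive (ℤ.*-zeroʳ (+ z))))) q∤a
    nonzero (suc w) _    = z<s

  product-units-nonresidue : ∀ {a} → ¬ + q ∣ a → (∀ x → ¬ x * x ≈ a [mod q ]) →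
                             + product (units q) ≈ a ^ h [mod q ]
  product-units-nonresidue q∤a nonresidue =
    product-of-partners q-prime _ h length-units (units-unique {q}) id (units-partners q∤a) (λ {z} _ → nonresidue (+ z))

  module _ {a : ℤ} {r : ℕ} (0<r : 0 < r) (r<q : r < q) (rr≈a : + r * + r ≈ a [mod q ]) where

    private
      r′ : ℕ
      r′ = q ∸ r

      r∈units : r ∈ units q
      r∈units = ∈-units⁺ 0<r r<q

      r′∈units : r′ ∈ units q
      r′∈units = ∈-units⁺ (ℕ.m<n⇒0<n∸m r<q) (ℕ.∸-monoʳ-< 0<r (ℕ.<⇒≤ r<q))

      r≢r′ : r ≢ r′
      r≢r′ r≡r′ = even≢odd r h (begin
        r ℕ.+ r        ≡⟨ cong (ℕ._+ r) r≡r′ ⟩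
        q ∸ r ℕ.+ r    ≡⟨ ℕ.m∸n+n≡m (ℕ.<⇒≤ r<q) ⟩
        q              ≡⟨ q≡1+2h ⟩
        suc (h ℕ.+ h)  ∎)
        where open ≡-Reasoning

      r′≈-r : + r′ ≈ - + r [mod q ]
      r′≈-r = ∸≈- (ℕ.<⇒≤ r<q)

      r′r′≈a : + r′ * + r′ ≈ a [mod q ]
      r′r′≈a = ≈-trans (*-cong r′≈-r r′≈-r) (≈-trans (≈-reflexive (lemma (+ r))) rr≈a)
        where lemma : ∀ r → - r * - r ≡ r * r
              lemma = solve-∀

      q∤a : ¬ + q ∣ a
      q∤a = ∤*∤⇒∤* q-prime (∈-units⇒∤ r∈units) (∈-units⇒∤ r∈units) ∘ ∣-resp-≈ (≈-sym rr≈a)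

    -- The square roots r and q − r of a contribute r (q − r) ≡ − a; the other units pair off.
    product-units-square : + product (units q) ≈ - (a ^ h) [mod q ]
    product-units-square with ys , units↭ ← extract₂ r∈units r′∈units r≢r′ = begin
      + product (units q)               ≡⟨ +product-↭∷∷ units↭ ⟩
      + r * (+ r′ * + product ys)       ≈⟨ *-congˡ (+ r) (*-cong r′≈-r product-ys) ⟩
      + r * (- + r * a ^ k)             ≡⟨ lemma (+ r) (a ^ k) ⟩
      - ((+ r * + r) * a ^ k)           ≈⟨ -‿cong (*-congʳ (a ^ k) rr≈a) ⟩
      - (a ^ suc k)                     ≡⟨ cong (λ n → - (a ^ n)) h≡1+k ⟨
      - (a ^ h)                         ∎
      where
      open ≈-Reasoning q
      lemma : ∀ r x → r * (- r * x) ≡ - ((r * r) * x)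
      lemma = solve-∀

      unique : Unique (r ∷ r′ ∷ ys)
      unique = Unique-resp-↭ units↭ (units-unique {q})

      ⊆units : r ∷ r′ ∷ ys ⊆ units q
      ⊆units = ∈-resp-↭ (↭-sym units↭)

      partners : HasPartners q-prime a ys
      partners = HasPartners-drop q-prime a unique ⊆units (here refl) rr≈a (there (here refl)) r′r′≈a
                   (HasPartners-resp-↭ q-prime a units↭ (units-partners q∤a))

      no-root : NoSquareRoot q-prime a ys
      no-root {z} z∈ys zz≈a = Unique[x∷y∷ys]⇒∉ys unique z∈pair z∈ys
        where
        z∈pair : z ∈ r ∷ r′ ∷ []
        z∈pair with square-roots q-prime 0<r r<q (proj₂ (∈-units⁻ (⊆units (there (there z∈ys)))))
                                 (≈-trans zz≈a (≈-sym rr≈a))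
        ... | inj₁ refl = here refl
        ... | inj₂ refl = there (here refl)

      product-ys : + product ys ≈ a ^ k [mod q ]
      product-ys = product-of-partners q-prime a k (length-drop₂ units↭) (drop⁺ 2 unique)
                     (⊆units ∘ there ∘ there) partners no-root

  wilson : + product (units q) ≈ - 1ℤ [mod q ]
  wilson = ≈-trans (product-units-square {a = 1ℤ} z<s (prime⇒>1 q-prime) ≈-refl)
                   (≈-reflexive (cong -_ (ℤ.^-zeroˡ h)))

  euler-residue : ∀ {a x} → ¬ + q ∣ a → x * x ≈ a [mod q ] → a ^ h ≈ 1ℤ [mod q ]
  euler-residue {a} {x} q∤a xx≈a =
    let r , (0<r , r<q) , x≈r = nonzero-residue q-prime q∤x
        rr≈a = ≈-trans (*-cong (≈-sym x≈r) (≈-sym x≈r)) xx≈a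
        -aʰ≈-1 = ≈-trans (≈-sym (product-units-square 0<r r<q rr≈a)) wilson
    in subst₂ (λ u v → u ≈ v [mod q ]) (ℤ.neg-involutive (a ^ h)) refl (-‿cong -aʰ≈-1)
    where
    q∤x : ¬ + q ∣ x
    q∤x q∣x = q∤a (∣-resp-≈ xx≈a (Signed.∣m⇒∣m*n x q∣x))

  euler-nonresidue : ∀ {a} → ¬ + q ∣ a → (∀ x → ¬ x * x ≈ a [mod q ]) → a ^ h ≈ - 1ℤ [mod q ]
  euler-nonresidue q∤a nonresidue = ≈-trans (≈-sym (product-units-nonresidue q∤a nonresidue)) wilson

  -- Being a square modulo q need not be decidable, but a^(2h) ≡ 1 is, which licenses the
  -- case analysis.
  fermat-odd : ∀ {a} → ¬ + q ∣ a → a ^ (h ℕ.+ h) ≈ 1ℤ [mod q ]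
  fermat-odd {a} q∤a = decidable-stable (≈-dec _ _) λ a²ʰ≉1 →
    let nonresidue : ∀ x → ¬ x * x ≈ a [mod q ]
        nonresidue x xx≈a = a²ʰ≉1 (square≈1 (euler-residue {x = x} q∤a xx≈a) refl)
    in a²ʰ≉1 (square≈1 (euler-nonresidue q∤a nonresidue) refl)
    where
    square≈1 : ∀ {s} → a ^ h ≈ s [mod q ] → s * s ≡ 1ℤ → a ^ (h ℕ.+ h) ≈ 1ℤ [mod q ]
    square≈1 aʰ≈s s²≡1 =
      ≈-trans (≈-reflexive (ℤ.^-distribˡ-+-* a h h)) (≈-trans (*-cong aʰ≈s aʰ≈s) (≈-reflexive s²≡1))

  1≉-1 : ¬ 1ℤ ≈ - 1ℤ [mod q ]
  1≉-1 1≈-1 = ℕ.<⇒≱ 2<q (ℕD.∣⇒≤ (≈⇒≡[mod] 1≈-1))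
    where
    2<q : 2 < q
    2<q = subst (2 <_) (sym q≡1+2h) (s≤s (ℕ.+-mono-≤ (ℕ.n≢0⇒n>0 h≢0) (ℕ.n≢0⇒n>0 h≢0)))

fermat : ∀ {p a} → Prime p → ¬ + p ∣ a → a ^ (p ∸ 1) ≈ 1ℤ [mod p ]
fermat {p} {a} p-prime p∤a with parity p
... | h , inj₂ p≡1+2h =
  subst (λ n → a ^ n ≈ 1ℤ [mod p ]) (sym (cong (_∸ 1) p≡1+2h)) (fermat-odd {h = h} p-prime p≡1+2h p∤a)
... | h , inj₁ p≡2h with prime⇒irreducible p-prime (ℕD.divides h (trans p≡2h 2h≡h*2))
  where 2h≡h*2 : h ℕ.+ h ≡ h ℕ.* 2
        2h≡h*2 = trans (cong (λ n → h ℕ.+ n) (sym (ℕ.+-identityʳ h))) (ℕ.*-comm 2 h)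
...   | inj₁ ()
...   | inj₂ refl with nonzero-residue p-prime p∤a
...     | suc zero , _ , a≈1 = ≈-trans (≈-reflexive (ℤ.^-identityʳ a)) a≈1
...     | suc (suc _) , (_ , s≤s (s≤s ())) , _

data SymbolsAgree (k : ℕ) (a : ℤ) (p q : ℕ) : Set where
  both    : IsPowRes k a p → IsPowRes k a q → SymbolsAgree k a p q
  neither : ¬ IsPowRes k a p → ¬ IsPowRes k a q → SymbolsAgree k a p q

SymbolsAgree-comm : ∀ {k a p q} → SymbolsAgree k a p q ⇔ SymbolsAgree k a q p
SymbolsAgree-comm = mk⇔ swap swap
  where
  swap : ∀ {k a p q} → SymbolsAgree k a p q → SymbolsAgree k a q p
  swap (both res-p res-q)       = both res-q res-p
  swap (neither ¬res-p ¬res-q) = neither ¬res-q ¬res-p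

PowSymList-pair⇔ : ∀ k a p q → PowSymList k a (p ∷ q ∷ []) 1ℤ ⇔ SymbolsAgree k a p q
PowSymList-pair⇔ k a p q = mk⇔ to from
  where
  to : PowSymList k a (p ∷ q ∷ []) 1ℤ → SymbolsAgree k a p q
  to (_ , _ , inj₁ (refl , res-p) , (_ , _ , inj₁ (refl , res-q) , refl , refl) , _)   = both res-p res-q
  to (_ , _ , inj₂ (refl , ¬res-p) , (_ , _ , inj₂ (refl , ¬res-q) , refl , refl) , _) = neither ¬res-p ¬res-q
  to (_ , _ , inj₁ (refl , _) , (_ , _ , inj₂ (refl , _) , refl , refl) , ())
  to (_ , _ , inj₂ (refl , _) , (_ , _ , inj₁ (refl , _) , refl , refl) , ())

  from : SymbolsAgree k a p q → PowSymList k a (p ∷ q ∷ []) 1ℤ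
  from (both res-p res-q) =
    1ℤ , 1ℤ , inj₁ (refl , res-p) , (1ℤ , 1ℤ , inj₁ (refl , res-q) , refl , refl) , refl
  from (neither ¬res-p ¬res-q) =
    -1ℤ , -1ℤ , inj₂ (refl , ¬res-p) , (-1ℤ , 1ℤ , inj₂ (refl , ¬res-q) , refl , refl) , refl

≡[mod*]⇒≈ˡ : ∀ {m x y} n → x ≡ y [mod m ℕ.* n ] → x ≈ y [mod m ]
≡[mod*]⇒≈ˡ n x≡y = ≡[mod]⇒≈ (ℕD.∣-trans (ℕD.m∣m*n n) x≡y)

≡[mod*]⇒≈ʳ : ∀ {n x y} m → x ≡ y [mod m ℕ.* n ] → x ≈ y [mod n ]
≡[mod*]⇒≈ʳ m x≡y = ≡[mod]⇒≈ (ℕD.∣-trans (ℕD.n∣m*n m) x≡y)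

module _ {p q : ℕ} (p-prime : Prime p) (q-prime : Prime q) (p≢q : p ≢ q) where

  distinct-primes-coprime : Coprime p q
  distinct-primes-coprime (d∣p , d∣q) with prime⇒irreducible p-prime d∣p
  ... | inj₁ d≡1 = d≡1
  ... | inj₂ refl with prime⇒irreducible q-prime d∣q
  ...   | inj₁ p≡1 = contradiction p≡1 (prime⇒≢1 p-prime)
  ...   | inj₂ p≡q = contradiction p≡q p≢q

  ≈-combine : ∀ {x y} → x ≈ y [mod p ] → x ≈ y [mod q ] → x ≡ y [mod p ℕ.* q ]
  ≈-combine x≈y[p] x≈y[q] with ℕD.divides k eq ← ≈⇒≡[mod] x≈y[q]
    with ℕD.divides j refl ← coprime-divisor distinct-primes-coprime
                                (subst (p ℕD.∣_) (trans eq (ℕ.*-comm k q)) (≈⇒≡[mod] x≈y[p]))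
    = ℕD.divides j (trans eq (ℕ.*-assoc j p q))

  chinese-remainder : ∀ u v → ∃ λ x → x ≈ u [mod p ] × x ≈ v [mod q ]
  chinese-remainder u v =
    let s , ps≈1 = inverse q-prime q∤p
    in u + (+ p * s) * (v - u) ,
       divides-diff (divides (s * (v - u)) (lemma₁ u (+ p) s v)) ,
       ≈-trans (+-cong (≈-refl {x = u}) (*-congʳ (v - u) ps≈1)) (≈-reflexive (lemma₂ u v))
    where
    q∤p : ¬ + q ∣ + p
    q∤p q∣p = prime⇒≢1 q-prime (distinct-primes-coprime (Signed.∣⇒∣ᵤ q∣p , ℕD.∣-refl))
    lemma₁ : ∀ u p s v → u + (p * s) * (v - u) - u ≡ (s * (v - u)) * p
    lemma₁ = solve-∀
    lemma₂ : ∀ u v → u + 1ℤ * (v - u) ≡ v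
    lemma₂ = solve-∀

  squares⇒square : ∀ {a} → IsPowRes 1 a p → IsPowRes 1 a q → ∃ λ x → (x ^ 2) ≡ a [mod p ℕ.* q ]
  squares⇒square (xₚ , xₚ²≡a) (x_q , x_q²≡a) =
    let x , x≈xₚ , x≈x_q = chinese-remainder xₚ x_q
    in x , ≈-combine (≈-trans (^-cong 2 x≈xₚ) (≡[mod]⇒≈ xₚ²≡a))
                     (≈-trans (^-cong 2 x≈x_q) (≡[mod]⇒≈ x_q²≡a))

square⇒IsPowRes : ∀ {n a} x e → x ^ 2 ≈ a [mod n ] → IsPowRes (suc e) (a ^ (2 ℕ.^ e)) n
square⇒IsPowRes x e x²≈a =
  x , ≈⇒≡[mod] (≈-trans (≈-reflexive (sym (ℤ.^-*-assoc x 2 (2 ℕ.^ e)))) (^-cong (2 ℕ.^ e) x²≈a))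

IsNu2⇒IsPowRes : ∀ {p e a} → Prime p → IsNu2 (p ∸ 1) e → ¬ + p ∣ a → IsPowRes (suc e) (a ^ (2 ℕ.^ e)) p
IsNu2⇒IsPowRes {p} {e} {a} p-prime ν₂[p-1]≡e p∤a with r , p-1≡ ← IsNu2⇒odd-part ν₂[p-1]≡e =
  a ^ suc r , ≈⇒≡[mod] (begin
    (a ^ suc r) ^ (2 ℕ.^ suc e)        ≡⟨ ℤ.^-*-assoc a (suc r) (2 ℕ.^ suc e) ⟩
    a ^ (suc r ℕ.* (2 ℕ.^ suc e))      ≡⟨ cong (a ^_) (trans (lemma r (2 ℕ.^ e)) (cong (ℕ._+ 2 ℕ.^ e) (sym p-1≡))) ⟩
    a ^ (p ∸ 1 ℕ.+ 2 ℕ.^ e)            ≡⟨ ℤ.^-distribˡ-+-* a (p ∸ 1) _ ⟩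
    a ^ (p ∸ 1) * a ^ (2 ℕ.^ e)        ≈⟨ *-congʳ (a ^ (2 ℕ.^ e)) (fermat p-prime p∤a) ⟩
    1ℤ * a ^ (2 ℕ.^ e)                 ≡⟨ ℤ.*-identityˡ _ ⟩
    a ^ (2 ℕ.^ e)                      ∎)
  where
  open ≈-Reasoning p
  lemma : ∀ r E → suc r ℕ.* (2 ℕ.* E) ≡ E ℕ.* suc (r ℕ.+ r) ℕ.+ E
  lemma = ℕ-Solver.solve-∀

-- Euler's criterion only excludes the non-residue case, hence the double negation.
IsPowRes⇒¬¬square : ∀ {q e t a} → Prime q → q ≡ suc (2 ℕ.^ e ℕ.* t ℕ.+ 2 ℕ.^ e ℕ.* t) → ¬ + q ∣ a →
                    IsPowRes (suc e) (a ^ (2 ℕ.^ e)) q → ¬ ¬ IsPowRes 1 a q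
IsPowRes⇒¬¬square {q} {e} {t} {a} q-prime q≡1+2h q∤a (w , w^2^[1+e]≡a^2^e) not-square =
  1≉-1 {h = h} q-prime q≡1+2h (begin
    1ℤ                           ≈⟨ fermat-odd {h = h} q-prime q≡1+2h q∤w ⟨
    w ^ (h ℕ.+ h)                ≡⟨ cong (w ^_) (lemma (2 ℕ.^ e) t) ⟨
    w ^ (2 ℕ.^ suc e ℕ.* t)      ≡⟨ ℤ.^-*-assoc w (2 ℕ.^ suc e) t ⟨
    (w ^ (2 ℕ.^ suc e)) ^ t      ≈⟨ ^-cong t w^2^[1+e]≈a^2^e ⟩
    (a ^ (2 ℕ.^ e)) ^ t          ≡⟨ ℤ.^-*-assoc a (2 ℕ.^ e) t ⟩
    a ^ h                        ≈⟨ euler-nonresidue {h = h} q-prime q≡1+2h q∤a nonresidue ⟩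
    -1ℤ                          ∎)
  where
  open ≈-Reasoning q
  h : ℕ
  h = 2 ℕ.^ e ℕ.* t

  lemma : ∀ E t → (2 ℕ.* E) ℕ.* t ≡ E ℕ.* t ℕ.+ E ℕ.* t
  lemma = ℕ-Solver.solve-∀

  w^2^[1+e]≈a^2^e : w ^ (2 ℕ.^ suc e) ≈ a ^ (2 ℕ.^ e) [mod q ]
  w^2^[1+e]≈a^2^e = ≡[mod]⇒≈ w^2^[1+e]≡a^2^e

  q∤w : ¬ + q ∣ w
  q∤w = ∤⇒∤^ q-prime (2 ℕ.^ e) q∤a ∘ ∣-resp-≈ w^2^[1+e]≈a^2^e
      ∘ ∣⇒∣^ (2 ℕ.^ suc e) {{ℕ.m^n≢0 2 (suc e)}}

  nonresidue : ∀ x → ¬ x * x ≈ a [mod q ]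
  nonresidue x xx≈a = not-square (x , ≈⇒≡[mod] (≈-trans (≈-reflexive (cong (x *_) (ℤ.*-identityʳ x))) xx≈a))

coprime⇒∤ : ∀ {a p N} → Prime p → p ℕD.∣ N → Coprime ℤ.∣ a ∣ N → ¬ + p ∣ a
coprime⇒∤ p-prime p∣N coprime p∣a = prime⇒≢1 p-prime (coprime (Signed.∣⇒∣ᵤ p∣a , p∣N))

criterion-ordered : ∀ {p q e f a} → Prime p → Prime q → IsNu2 (p ∸ 1) e → IsNu2 (q ∸ 1) f → e < f →
  Coprime ℤ.∣ a ∣ (p ℕ.* q) → SymbolsAgree 1 a p q →
  IsNu2 (p ℕ.* q ∸ 1) e × (InZStar2 (p ℕ.* q) a ⇔ SymbolsAgree (suc e) (a ^ (2 ℕ.^ e)) p q)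
criterion-ordered {p} {q} {e} {f} {a} p-prime q-prime ν₂[p-1]≡e ν₂[q-1]≡f e<f coprime squares =
  IsNu2-pred-* {{prime⇒nonZero p-prime}} {{prime⇒nonZero q-prime}} ν₂[p-1]≡e ν₂[q-1]≡f e<f , mk⇔ to from
  where
  p∤a : ¬ + p ∣ a
  p∤a = coprime⇒∤ p-prime (ℕD.m∣m*n q) coprime
  q∤a : ¬ + q ∣ a
  q∤a = coprime⇒∤ q-prime (ℕD.n∣m*n p) coprime
  p≢q : p ≢ q
  p≢q refl = ℕ.<⇒≢ e<f (IsNu2-unique ν₂[p-1]≡e ν₂[q-1]≡f)

  to : InZStar2 (p ℕ.* q) a → SymbolsAgree (suc e) (a ^ (2 ℕ.^ e)) p q
  to (_ , x , x²≡a) = both (square⇒IsPowRes x e x²≈a[p]) (square⇒IsPowRes x e x²≈a[q])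
    where
    x²≈a[p] : x ^ 2 ≈ a [mod p ]
    x²≈a[p] = ≡[mod*]⇒≈ˡ q x²≡a
    x²≈a[q] : x ^ 2 ≈ a [mod q ]
    x²≈a[q] = ≡[mod*]⇒≈ʳ p x²≡a

  from : SymbolsAgree (suc e) (a ^ (2 ℕ.^ e)) p q → InZStar2 (p ℕ.* q) a
  from (neither ¬res-p _) = contradiction (IsNu2⇒IsPowRes p-prime ν₂[p-1]≡e p∤a) ¬res-p
  from (both _ res-q) = coprime , square-mod-pq squares
    where
    square-mod-pq : SymbolsAgree 1 a p q → ∃ λ x → (x ^ 2) ≡ a [mod p ℕ.* q ]
    square-mod-pq (both square-p square-q) = squares⇒square p-prime q-prime p≢q square-p square-q
    square-mod-pq (neither _ ¬square-q) =
      let t , q≡ = IsNu2⇒pred-halves {{prime⇒nonZero q-prime}} ν₂[q-1]≡f e<f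
      in contradiction ¬square-q (IsPowRes⇒¬¬square {e = e} {t = t} q-prime q≡ q∤a res-q)

InZStar2-*-comm : ∀ {a} p q → InZStar2 (p ℕ.* q) a ⇔ InZStar2 (q ℕ.* p) a
InZStar2-*-comm {a} p q = subst (λ N → InZStar2 (p ℕ.* q) a ⇔ InZStar2 N a) (ℕ.*-comm p q) ⇔-refl

criterion : ∀ {p q e f a} → Prime p → Prime q → IsNu2 (p ∸ 1) e → IsNu2 (q ∸ 1) f → e ≢ f →
  Coprime ℤ.∣ a ∣ (p ℕ.* q) → SymbolsAgree 1 a p q →
  ∃ λ v → IsNu2 (p ℕ.* q ∸ 1) v × (InZStar2 (p ℕ.* q) a ⇔ SymbolsAgree (suc v) (a ^ (2 ℕ.^ v)) p q)
criterion {p} {q} {e} {f} {a} p-prime q-prime ν₂[p-1]≡e ν₂[q-1]≡f e≢f coprime squares with ℕ.<-cmp e f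
... | tri< e<f _ _ = e , criterion-ordered p-prime q-prime ν₂[p-1]≡e ν₂[q-1]≡f e<f coprime squares
... | tri≈ _ e≡f _ = contradiction e≡f e≢f
... | tri> _ _ f<e =
  let ν₂[qp-1]≡f , equiv = criterion-ordered q-prime p-prime ν₂[q-1]≡f ν₂[p-1]≡e f<e
                             (subst (Coprime ℤ.∣ a ∣) (ℕ.*-comm p q) coprime)
                             (Equivalence.to SymbolsAgree-comm squares)
  in f , subst (λ N → IsNu2 (N ∸ 1) f) (ℕ.*-comm q p) ν₂[qp-1]≡f
       , ⇔-trans (InZStar2-*-comm p q) (⇔-trans equiv SymbolsAgree-comm)

theorem10 : (p q : ℕ) → Prime p → Prime q →
  (∀ k l → IsNu2 (p ∸ 1) k → IsNu2 (q ∸ 1) l → k ≢ l) →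
  (a : ℤ) → Coprime ℤ.∣ a ∣ (p ℕ.* q) →
  PowSymList 1 a (p ∷ q ∷ []) 1ℤ →
  (v : ℕ) → IsNu2 (p ℕ.* q ∸ 1) v →
  (InZStar2 (p ℕ.* q) a ⇔ PowSymList (ℕ.suc v) (a ^ (2 ℕ.^ v)) (p ∷ q ∷ []) 1ℤ)
theorem10 p q p-prime q-prime ν₂-distinct a coprime symbol v ν₂[pq-1]≡v =
  let e , ν₂[p-1]≡e = IsNu2-exists (ℕ.m>n⇒m∸n≢0 (prime⇒>1 p-prime))
      f , ν₂[q-1]≡f = IsNu2-exists (ℕ.m>n⇒m∸n≢0 (prime⇒>1 q-prime))
      w , ν₂[pq-1]≡w , equiv = criterion p-prime q-prime ν₂[p-1]≡e ν₂[q-1]≡f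
                                 (ν₂-distinct e f ν₂[p-1]≡e ν₂[q-1]≡f)
                                 coprime (Equivalence.to (PowSymList-pair⇔ 1 a p q) symbol)
  in subst (λ u → InZStar2 (p ℕ.* q) a ⇔ PowSymList (suc u) (a ^ (2 ℕ.^ u)) (p ∷ q ∷ []) 1ℤ)
           (IsNu2-unique ν₂[pq-1]≡w ν₂[pq-1]≡v)
           (⇔-trans equiv (⇔-sym (PowSymList-pair⇔ (suc w) (a ^ (2 ℕ.^ w)) p q)))
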